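{- Let $A[1..n]$ be a 1D array with entries from an alphabet $\{0,\dots,\sigma-1\}$ of size $\sigma$. Then the left height of the Cartesian tree $C(A)$ is at most $\sigma-1$.
   Context: For $1\le i\le j\le n$, $\mathsf{rmq}(i,j)$ returns the position of a smallest element of $A[i..j]$, breaking ties by returning the leftmost such position. The Cartesian tree $C(A)$ is the unlabeled binary tree defined recursively: its root corresponds to position $p=\mathsf{rmq}(1,n)$; its left subtree is the Cartesian tree of $A[1..p-1]$ (if nonempty) and its right subtree is the Cartesian tree of $A[p+1..n]$ (if nonempty). The left height of a binary tree is the maximum number of left edges on any root-to-leaf path. -}

module Defs where

open import Data.Nat using (ℕ; zero; suc; _⊔_; _≤?_; _<?_)
open import Data.Fin using (Fin; toℕ)
open import Data.List using (List; []; _∷_; length; take; drop)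
open import Data.Product using (_×_; _,_)
open import Relation.Nullary using (yes; no)

-- Unlabeled binary trees; `leaf` is the empty tree.
data Tree : Set where
  leaf : Tree
  node : Tree → Tree → Tree

-- Left height: maximum number of left edges on a root-to-leaf path.
-- (The empty tree and a single node have left height 0.)
leftHeight : Tree → ℕ
leftHeight leaf = 0
leftHeight (node leaf r) = leftHeight r
leftHeight (node l@(node _ _) r) = suc (leftHeight l) ⊔ leftHeight r

-- Positions are 0-based here.  rmqAux x i xs : given current best value x
-- found at position i, scan the rest xs (starting at position (suc i ...)).
-- Returns the position of the leftmost minimum.
rmqFrom : ℕ → ℕ → ℕ → List ℕ → ℕ
rmqFrom best bestPos pos [] = bestPos
rmqFrom best bestPos pos (y ∷ ys) with y <? best
... | yes _ = rmqFrom y pos (suc pos) ys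
... | no  _ = rmqFrom best bestPos (suc pos) ys

rmq : List ℕ → ℕ
rmq [] = 0
rmq (x ∷ xs) = rmqFrom x 0 1 xs

-- Cartesian tree, with fuel (fuel ≥ length suffices; each recursive call
-- is on a strictly shorter list).
cartesianFuel : ℕ → List ℕ → Tree
cartesianFuel zero _ = leaf
cartesianFuel (suc k) [] = leaf
cartesianFuel (suc k) xs@(_ ∷ _) =
  let p = rmq xs in
  node (cartesianFuel k (take p xs)) (cartesianFuel k (drop (suc p) xs))

cartesianTreeℕ : List ℕ → Tree
cartesianTreeℕ xs = cartesianFuel (length xs) xs

toℕs : {σ : ℕ} → List (Fin σ) → List ℕ
toℕs [] = []
toℕs (x ∷ xs) = toℕ x ∷ toℕs xs

cartesianTree : {σ : ℕ} → List (Fin σ) → Tree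
cartesianTree A = cartesianTreeℕ (toℕs A)

-- The root of a Cartesian tree sits at the leftmost minimum v of the array, so every
-- entry of the left subarray is strictly larger than v.  Hence if all entries lie in
-- [m, σ), each left edge raises the lower bound by at least one while the upper bound
-- stays σ: a nonempty Cartesian tree over [m, σ) has m + left height < σ.
{-# OPTIONS --safe #-}
module Submission where

open import Defs
open import Data.Nat using (ℕ; _≤_; _∸_)
open import Data.Fin using (Fin)
open import Data.List using (List)

open import Data.Nat using (zero; suc; _+_; _<_; _<?_; z≤n; s≤s)
open import Data.Nat.Properties
open import Data.Fin using (toℕ)
open import Data.Fin.Properties using (toℕ<n)
open import Data.List using ([]; _∷_; _++_; _∷ʳ_; [_]; length; take; drop)
open import Data.List.Properties using (++-assoc; ++-identityʳ; ∷ʳ-++; length-++)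
open import Data.List.Relation.Unary.All as All using (All; []; _∷_)
open import Data.List.Relation.Unary.All.Properties using (++⁺; ++⁻; ∷ʳ⁺)
open import Data.Product using (_×_; _,_)
open import Function using (_∘_)
open import Data.Sum using (_⊎_; inj₁; inj₂)
open import Relation.Nullary using (yes; no)
open import Relation.Binary.PropositionalEquality using (_≡_; refl; sym; trans; cong; cong₂; subst)

private
  variable
    X : Set

length-∷ʳ : ∀ (xs : List X) x → length (xs ∷ʳ x) ≡ suc (length xs)
length-∷ʳ xs x = trans (length-++ xs) (+-comm (length xs) 1)

take-length-++ : ∀ (xs ys : List X) → take (length xs) (xs ++ ys) ≡ xs
take-length-++ []       ys = refl
take-length-++ (x ∷ xs) ys = cong (x ∷_) (take-length-++ xs ys)

drop-suc-length-++ : ∀ (xs : List X) y ys → drop (suc (length xs)) (xs ++ y ∷ ys) ≡ ys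
drop-suc-length-++ []       y ys = refl
drop-suc-length-++ (x ∷ xs) y ys = drop-suc-length-++ xs y ys

++-∷⁻ : ∀ {P : X → Set} xs {y ys} → All P (xs ++ y ∷ ys) → All P xs × P y × All P ys
++-∷⁻ xs pxys with ++⁻ xs pxys
... | pxs , py ∷ pys = pxs , py , pys

record LeftmostMinimum (xs : List ℕ) (p : ℕ) : Set where
  field
    before   : List ℕ
    minimum  : ℕ
    after    : List ℕ
    split    : xs ≡ before ++ minimum ∷ after
    position : length before ≡ p
    before-> : All (minimum <_) before
    after-≥  : All (minimum ≤_) after

-- Loop invariant of the scan: best is the leftmost minimum of the consumed prefix a ++ best ∷ b.
rmqFrom-leftmostMinimum :
  ∀ {xs} best bestPos pos ys a b →
  xs ≡ a ++ best ∷ b ++ ys → length a ≡ bestPos → length (a ++ best ∷ b) ≡ pos →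
  All (best <_) a → All (best ≤_) b →
  LeftmostMinimum xs (rmqFrom best bestPos pos ys)
rmqFrom-leftmostMinimum best bestPos pos [] a b xs≡ a≡ _ a> b≥ = record
  { before = a ; minimum = best ; after = b
  ; split = trans xs≡ (cong (λ c → a ++ best ∷ c) (++-identityʳ b))
  ; position = a≡ ; before-> = a> ; after-≥ = b≥ }
rmqFrom-leftmostMinimum best bestPos pos (y ∷ ys) a b xs≡ a≡ pos≡ a> b≥ with y <? best
... | yes y<best =
  rmqFrom-leftmostMinimum y pos (suc pos) ys (a ++ best ∷ b) []
    (trans xs≡ (sym (++-assoc a (best ∷ b) (y ∷ ys))))
    pos≡
    (trans (length-∷ʳ (a ++ best ∷ b) y) (cong suc pos≡))
    (++⁺ (All.map (<-trans y<best) a>) (y<best ∷ All.map (<-≤-trans y<best) b≥))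
    []
... | no y≮best =
  rmqFrom-leftmostMinimum best bestPos (suc pos) ys a (b ∷ʳ y)
    (trans xs≡ (cong (λ c → a ++ best ∷ c) (sym (∷ʳ-++ b y ys))))
    a≡
    (trans (cong length (sym (++-assoc a (best ∷ b) [ y ])))
           (trans (length-∷ʳ (a ++ best ∷ b) y) (cong suc pos≡)))
    a>
    (∷ʳ⁺ b≥ (≮⇒≥ y≮best))

rmq-leftmostMinimum : ∀ x xs → LeftmostMinimum (x ∷ xs) (rmq (x ∷ xs))
rmq-leftmostMinimum x xs = rmqFrom-leftmostMinimum x 0 1 xs [] [] refl refl refl [] []

cartesianFuel-leftmostMinimum :
  ∀ k x xs → (leftmost : LeftmostMinimum (x ∷ xs) (rmq (x ∷ xs))) →
  let open LeftmostMinimum leftmost in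
  cartesianFuel (suc k) (x ∷ xs) ≡ node (cartesianFuel k before) (cartesianFuel k after)
cartesianFuel-leftmostMinimum k x xs leftmost = cong₂ node
  (cong (cartesianFuel k) (trans (cong₂ take (sym position) split) (take-length-++ before _)))
  (cong (cartesianFuel k) (trans (cong₂ drop (cong suc (sym position)) split)
                                 (drop-suc-length-++ before minimum after)))
  where open LeftmostMinimum leftmost

-- Empty trees are exempt: they arise from empty subarrays, for which [m, σ) may be empty.
LeftHeightBelow : ℕ → ℕ → Tree → Set
LeftHeightBelow σ m t = t ≡ leaf ⊎ m + leftHeight t < σ

leftHeightBelow-< : ∀ {σ m t} → m < σ → LeftHeightBelow σ m t → m + leftHeight t < σ
leftHeightBelow-< {m = m} m<σ (inj₁ refl) = subst (_< _) (sym (+-identityʳ m)) m<σ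
leftHeightBelow-< m<σ (inj₂ below) = below

node-leftHeightBelow : ∀ {σ m v} l r → m ≤ v → v < σ →
  LeftHeightBelow σ (suc v) l → LeftHeightBelow σ m r → m + leftHeight (node l r) < σ
node-leftHeightBelow leaf r m≤v v<σ _ r-below = leftHeightBelow-< (≤-<-trans m≤v v<σ) r-below
node-leftHeightBelow {m = m} {v} l@(node _ _) r m≤v v<σ (inj₂ l-below) r-below =
  subst (_< _) (sym (+-distribˡ-⊔ m (suc (leftHeight l)) (leftHeight r)))
    (⊔-lub (≤-<-trans left-step l-below) (leftHeightBelow-< (≤-<-trans m≤v v<σ) r-below))
  where
  left-step : m + suc (leftHeight l) ≤ suc v + leftHeight l
  left-step = subst (_≤ suc v + leftHeight l) (sym (+-suc m (leftHeight l)))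
                    (s≤s (+-monoˡ-≤ (leftHeight l) m≤v))

cartesianFuel-leftHeightBelow : ∀ {σ m} k xs → All (m ≤_) xs → All (_< σ) xs →
  LeftHeightBelow σ m (cartesianFuel k xs)
cartesianFuel-leftHeightBelow zero    xs       _     _     = inj₁ refl
cartesianFuel-leftHeightBelow (suc k) []       _     _     = inj₁ refl
cartesianFuel-leftHeightBelow {σ} {m} (suc k) (x ∷ xs) lower upper =
  let (_ , m≤minimum , after-lower) = bounds lower
      (before-upper , minimum<σ , after-upper) = bounds upper
  in inj₂ (subst (λ t → m + leftHeight t < σ) (sym (cartesianFuel-leftmostMinimum k x xs leftmost))
    (node-leftHeightBelow _ _ m≤minimum minimum<σ
      (cartesianFuel-leftHeightBelow k before before-> before-upper)
      (cartesianFuel-leftHeightBelow k after after-lower after-upper)))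
  where
  leftmost = rmq-leftmostMinimum x xs
  open LeftmostMinimum leftmost
  bounds : ∀ {P : ℕ → Set} → All P (x ∷ xs) → All P before × P minimum × All P after
  bounds = ++-∷⁻ before ∘ subst (All _) split

toℕs-< : ∀ {σ} (A : List (Fin σ)) → All (_< σ) (toℕs A)
toℕs-< []      = []
toℕs-< (x ∷ A) = toℕ<n x ∷ toℕs-< A

leftHeightBelow-≤∸1 : ∀ {σ} t → LeftHeightBelow σ 0 t → leftHeight t ≤ σ ∸ 1
leftHeightBelow-≤∸1 _ (inj₁ refl) = z≤n
leftHeightBelow-≤∸1 _ (inj₂ below) = <⇒≤pred below

proposition3 : (σ : ℕ) (A : List (Fin σ)) →
    leftHeight (cartesianTree A) ≤ σ ∸ 1
proposition3 σ A = leftHeightBelow-≤∸1 (cartesianTree A)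
  (cartesianFuel-leftHeightBelow (length (toℕs A)) (toℕs A)
    (All.universal (λ _ → z≤n) (toℕs A)) (toℕs-< A))
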